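{- Let $s>4$ and let $V$ be the set of $s^2$ treatments of a pseudo-$L_3(s)$ association scheme. Suppose: (I) for every treatment $x$, the $3(s-1)$ first associates of $x$ can be divided into three pairwise disjoint sets $Y=\{y_1,\dots,y_{s-1}\}$, $Z=\{z_1,\dots,z_{s-1}\}$, $W=\{w_1,\dots,w_{s-1}\}$ such that any two distinct treatments within $Y$, within $Z$, and within $W$ are first associates; (I') for every $y\in Y$ there is exactly one treatment in $Z$ and exactly one treatment in $W$ that is a first associate of $y$; for every $z\in Z$ there is exactly one treatment in $Y$ and exactly one in $W$ that is a first associate of $z$; for every $w\in W$ there is exactly one treatment in $Y$ and exactly one in $Z$ that is a first associate of $w$. Then there exist three partitions $\mathcal P_v=\{B^v_1,\dots,B^v_s\}$ ($v=1,2,3$) of $V$, each into $s$ pairwise disjoint sets in each of which any two distinct treatments are first associates, such that for any $v\neq u$ in $\{1,2,3\}$ and any $i',j'\in\{1,\dots,s\}$, $B^v_{i'}$ and $B^u_{j'}$ have exactly one common treatment.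
   Context: An association scheme with two associate classes on $v$ treatments is a symmetric relation splitting every pair of distinct treatments into first or second associates such that each treatment has $n_i$ $i$-th associates and for two $i$-th associates the number of treatments that are $j$-th associates of the first and $k$-th associates of the second is a constant $p^i_{jk}$. A pseudo-$L_3(s)$ association scheme is such a scheme with $v=s^2$, $n_1=3(s-1)$, $p^1_{11}=s$, $p^2_{11}=6$. -}

module Defs where

open import Data.Nat using (ℕ; _*_; _∸_; _+_)
open import Data.Bool using (Bool; true; false; not; _∧_)
open import Data.Fin using (Fin; _≟_)
open import Data.Fin.Subset using (Subset; _∈_; _∩_; ∣_∣)
open import Data.Vec using (tabulate)
open import Data.Product using (_×_; Σ; ∃; _,_)
open import Data.Sum using (_⊎_)
open import Relation.Nullary using (¬_)
open import Relation.Nullary.Decidable using (⌊_⌋)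
open import Relation.Binary.PropositionalEquality using (_≡_; _≢_)

-- An association scheme with two associate classes is
-- encoded by a Boolean relation R: for distinct x y, R x y ≡ true means "first
-- associates", R x y ≡ false means "second associates".  R is symmetric and
-- irreflexive (R x x ≡ false; the diagonal is not an associate class).

data Cls : Set where
  c1 c2 : Cls

assoc : ∀ {v} → (Fin v → Fin v → Bool) → Cls → Fin v → Fin v → Bool
assoc R c1 x y = R x y
assoc R c2 x y = not (R x y) ∧ not ⌊ x ≟ y ⌋

assocSet : ∀ {v} → (Fin v → Fin v → Bool) → Cls → Fin v → Subset v
assocSet R i x = tabulate (assoc R i x)

record IsAssocScheme {v : ℕ} (R : Fin v → Fin v → Bool)
                     (n : Cls → ℕ) (p : Cls → Cls → Cls → ℕ) : Set where
  field
    irrefl : ∀ x → R x x ≡ false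
    sym    : ∀ x y → R x y ≡ R y x
    valency : ∀ i x → ∣ assocSet R i x ∣ ≡ n i
    intersection : ∀ i j k x y → assoc R i x y ≡ true →
      ∣ assocSet R j x ∩ assocSet R k y ∣ ≡ p i j k

IsPseudoL3 : (s : ℕ) → (Fin (s * s) → Fin (s * s) → Bool) → Set
IsPseudoL3 s R = Σ (Cls → ℕ) λ n → Σ (Cls → Cls → Cls → ℕ) λ p →
  IsAssocScheme R n p × n c1 ≡ 3 * (s ∸ 1) × p c1 c1 c1 ≡ s × p c2 c1 c1 ≡ 6

Clique : ∀ {v} → (Fin v → Fin v → Bool) → Subset v → Set
Clique R A = ∀ a b → a ∈ A → b ∈ A → a ≢ b → R a b ≡ true

Disjoint : ∀ {v} → Subset v → Subset v → Set
Disjoint A B = ∀ t → ¬ (t ∈ A × t ∈ B)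

ExactlyOneNbr : ∀ {v} → (Fin v → Fin v → Bool) → Subset v → Subset v → Set
ExactlyOneNbr R A B = ∀ a → a ∈ A → ∣ B ∩ assocSet R c1 a ∣ ≡ 1

CondI : ∀ {v} → ℕ → (Fin v → Fin v → Bool) → Fin v → Subset v → Subset v → Subset v → Set
CondI s R x Y Z W =
  (∀ t → (t ∈ Y ⊎ t ∈ Z ⊎ t ∈ W → R x t ≡ true) × (R x t ≡ true → t ∈ Y ⊎ t ∈ Z ⊎ t ∈ W)) ×
  ∣ Y ∣ ≡ s ∸ 1 × ∣ Z ∣ ≡ s ∸ 1 × ∣ W ∣ ≡ s ∸ 1 ×
  Disjoint Y Z × Disjoint Y W × Disjoint Z W ×
  Clique R Y × Clique R Z × Clique R W

CondI' : ∀ {v} → (Fin v → Fin v → Bool) → Subset v → Subset v → Subset v → Set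
CondI' R Y Z W =
  ExactlyOneNbr R Y Z × ExactlyOneNbr R Y W ×
  ExactlyOneNbr R Z Y × ExactlyOneNbr R Z W ×
  ExactlyOneNbr R W Y × ExactlyOneNbr R W Z

IsCliquePartition : ∀ {v} → (Fin v → Fin v → Bool) → (s : ℕ) → (Fin s → Subset v) → Set
IsCliquePartition R s P =
  (∀ i j → i ≢ j → Disjoint (P i) (P j)) ×
  (∀ t → ∃ λ i → t ∈ P i) ×
  (∀ i → Clique R (P i))

module Submission where

-- Call a pair (x , k) of a treatment x and a class k : Fin 3 of the
-- decomposition (I) at x a *line*; its points are x together with the k-th class at x,
-- so every line is a clique of s treatments.  Using (I') and s - 1 ≥ 4 one shows that
-- the lines form a partial linear space: a line is the same line seen from any of its
-- points, and two points lie on at most one common line.  The condition p²₁₁ = 6 then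
-- gives Playfair's axiom: a point t off a line ℓ is adjacent to at most two points of ℓ
-- (hence, as 2 + 2 < 6, to some point of ℓ), two of the three lines through t meet ℓ,
-- and exactly one line through t misses ℓ.  Consequently "equal or disjoint" is an
-- equivalence relation on lines, two non-parallel lines meet in exactly one point, and
-- the two lines through a point in different directions are not parallel.
-- Fixing a treatment x₀, the v-th partition consists of the lines parallel to the line
-- (x₀ , v), indexed by their intersections with a transversal line through x₀.

open import Defs
open import Data.Nat using (ℕ; zero; suc; _*_; _+_; _≤_; _<_; z≤n; s≤s)
open import Data.Nat.Properties using (≤-trans; ≤-reflexive; +-mono-≤; +-monoʳ-≤; n≤1+n; +-suc)
open import Data.Bool using (Bool; true; false)
open import Data.Bool.Properties using (¬-not)
open import Data.Fin using (Fin; zero; suc; _≟_; cast)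
open import Data.Fin.Properties using (any?; all?; suc-injective; cast-involutive)
open import Data.Fin.Subset
  using (Subset; _∈_; _∉_; _⊆_; _∩_; _∪_; _-_; ⁅_⁆; ∣_∣; Nonempty; Empty)
open import Data.Fin.Subset.Properties
  using ( _∈?_; ∣⊥∣≡0; ∣⁅x⁆∣≡1; p⊆q⇒∣p∣≤∣q∣; Empty-unique; nonempty?; x∈⁅x⁆; x∈⁅y⁆⇒x≡y
        ; ⊆-antisym; x∈p∩q⁺; x∈p∩q⁻; x∈p∪q⁺; x∈p∪q⁻; x∈p⇒∣p-x∣<∣p∣; x∈p∧x≢y⇒x∈p-y)
open import Data.Vec using ([]; _∷_; tabulate; here; there)
open import Data.Vec.Properties using ([]=⇒lookup; lookup⇒[]=; lookup∘tabulate)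
open import Data.Product using (_×_; Σ; ∃; _,_; proj₁; proj₂)
open import Data.Sum using (_⊎_; inj₁; inj₂)
open import Function using (_∘_)
open import Relation.Nullary using (¬_; yes; no; ¬?; contradiction)
open import Relation.Nullary.Decidable using (_×-dec_; _→-dec_; from-yes)
open import Relation.Binary.PropositionalEquality
  using (_≡_; _≢_; refl; sym; trans; cong; cong₂; subst)

∈-tabulate⁻ : ∀ {n} (f : Fin n → Bool) {t} → t ∈ tabulate f → f t ≡ true
∈-tabulate⁻ f {t} t∈ = trans (sym (lookup∘tabulate f t)) ([]=⇒lookup t∈)

∈-tabulate⁺ : ∀ {n} (f : Fin n → Bool) {t} → f t ≡ true → t ∈ tabulate f
∈-tabulate⁺ f {t} ft = lookup⇒[]= t (tabulate f) (trans (lookup∘tabulate f t) ft)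

disjoint-sym : ∀ {n} {A B : Subset n} → Disjoint A B → Disjoint B A
disjoint-sym d t (t∈B , t∈A) = d t (t∈A , t∈B)

∣p∪q∣≤∣p∣+∣q∣ : ∀ {n} (p q : Subset n) → ∣ p ∪ q ∣ ≤ ∣ p ∣ + ∣ q ∣
∣p∪q∣≤∣p∣+∣q∣ [] [] = z≤n
∣p∪q∣≤∣p∣+∣q∣ (false ∷ p) (false ∷ q) = ∣p∪q∣≤∣p∣+∣q∣ p q
∣p∪q∣≤∣p∣+∣q∣ (false ∷ p) (true ∷ q) =
  ≤-trans (s≤s (∣p∪q∣≤∣p∣+∣q∣ p q)) (≤-reflexive (sym (+-suc ∣ p ∣ ∣ q ∣)))
∣p∪q∣≤∣p∣+∣q∣ (true ∷ p) (false ∷ q) = s≤s (∣p∪q∣≤∣p∣+∣q∣ p q)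
∣p∪q∣≤∣p∣+∣q∣ (true ∷ p) (true ∷ q) =
  s≤s (≤-trans (∣p∪q∣≤∣p∣+∣q∣ p q) (+-monoʳ-≤ ∣ p ∣ (n≤1+n ∣ q ∣)))

∣⁅a⁆∪⁅b⁆∣≤2 : ∀ {n} (a b : Fin n) → ∣ ⁅ a ⁆ ∪ ⁅ b ⁆ ∣ ≤ 2
∣⁅a⁆∪⁅b⁆∣≤2 a b =
  ≤-trans (∣p∪q∣≤∣p∣+∣q∣ ⁅ a ⁆ ⁅ b ⁆) (≤-reflexive (cong₂ _+_ (∣⁅x⁆∣≡1 a) (∣⁅x⁆∣≡1 b)))

⊆pair⇒∣p∣≤2 : ∀ {n} {p : Subset n} a b → p ⊆ ⁅ a ⁆ ∪ ⁅ b ⁆ → ∣ p ∣ ≤ 2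
⊆pair⇒∣p∣≤2 a b p⊆ = ≤-trans (p⊆q⇒∣p∣≤∣q∣ p⊆) (∣⁅a⁆∪⁅b⁆∣≤2 a b)

⊆triple⇒∣p∣≤3 : ∀ {n} {p : Subset n} a b c → p ⊆ ⁅ a ⁆ ∪ (⁅ b ⁆ ∪ ⁅ c ⁆) → ∣ p ∣ ≤ 3
⊆triple⇒∣p∣≤3 a b c p⊆ =
  ≤-trans (p⊆q⇒∣p∣≤∣q∣ p⊆)
    (≤-trans (∣p∪q∣≤∣p∣+∣q∣ ⁅ a ⁆ (⁅ b ⁆ ∪ ⁅ c ⁆))
      (+-mono-≤ (≤-reflexive (∣⁅x⁆∣≡1 a)) (∣⁅a⁆∪⁅b⁆∣≤2 b c)))

Empty⇒∣p∣≡0 : ∀ {n} {p : Subset n} → Empty p → ∣ p ∣ ≡ 0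
Empty⇒∣p∣≡0 {n} e = trans (cong ∣_∣ (Empty-unique e)) (∣⊥∣≡0 n)

∈⇒1≤∣p∣ : ∀ {n} {p : Subset n} {x} → x ∈ p → 1 ≤ ∣ p ∣
∈⇒1≤∣p∣ {x = x} x∈p =
  ≤-trans (≤-reflexive (sym (∣⁅x⁆∣≡1 x)))
    (p⊆q⇒∣p∣≤∣q∣ (λ y∈⁅x⁆ → subst (_∈ _) (sym (x∈⁅y⁆⇒x≡y x y∈⁅x⁆)) x∈p))

∣p∣≡1⇒nonempty : ∀ {n} {p : Subset n} → ∣ p ∣ ≡ 1 → Nonempty p
∣p∣≡1⇒nonempty {p = p} ∣p∣≡1 with nonempty? p
... | yes ne = ne
... | no e with trans (sym (Empty⇒∣p∣≡0 e)) ∣p∣≡1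
... | ()

∣p∣≡1⇒unique : ∀ {n} {p : Subset n} → ∣ p ∣ ≡ 1 → ∀ {x y} → x ∈ p → y ∈ p → x ≡ y
∣p∣≡1⇒unique {p = p} ∣p∣≡1 {x} {y} x∈p y∈p with x ≟ y
... | yes x≡y = x≡y
... | no x≢y with ≤-trans (s≤s (∈⇒1≤∣p∣ (x∈p∧x≢y⇒x∈p-y y∈p (x≢y ∘ sym))))
                          (subst (∣ p - x ∣ <_) ∣p∣≡1 (x∈p⇒∣p-x∣<∣p∣ x∈p))
... | s≤s ()

singleton⇒∣p∣≡1 : ∀ {n} {p : Subset n} {x} → x ∈ p → (∀ {y} → y ∈ p → y ≡ x) → ∣ p ∣ ≡ 1
singleton⇒∣p∣≡1 {x = x} x∈p unique =
  trans (cong ∣_∣ (⊆-antisym (λ y∈p → subst (_∈ ⁅ x ⁆) (sym (unique y∈p)) (x∈⁅x⁆ x))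
                             (λ y∈⁅x⁆ → subst (_∈ _) (sym (x∈⁅y⁆⇒x≡y x y∈⁅x⁆)) x∈p)))
        (∣⁅x⁆∣≡1 x)

avoid : ∀ {n} (p : Subset n) → 4 ≤ ∣ p ∣ → ∀ a b c → ∃ λ t → t ∈ p × t ≢ a × t ≢ b × t ≢ c
avoid p 4≤∣p∣ a b c with any? (λ t → t ∈? p ×-dec ¬? (t ≟ a) ×-dec ¬? (t ≟ b) ×-dec ¬? (t ≟ c))
... | yes found = found
... | no none = contradiction (≤-trans 4≤∣p∣ (⊆triple⇒∣p∣≤3 a b c covered))
                              (λ { (s≤s (s≤s (s≤s ()))) })
  where
  covered : p ⊆ ⁅ a ⁆ ∪ (⁅ b ⁆ ∪ ⁅ c ⁆)
  covered {t} t∈p with t ≟ a | t ≟ b | t ≟ c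
  ... | yes refl | _ | _ = x∈p∪q⁺ (inj₁ (x∈⁅x⁆ t))
  ... | no _ | yes refl | _ = x∈p∪q⁺ (inj₂ (x∈p∪q⁺ (inj₁ (x∈⁅x⁆ t))))
  ... | no _ | no _ | yes refl = x∈p∪q⁺ (inj₂ (x∈p∪q⁺ (inj₂ (x∈⁅x⁆ t))))
  ... | no t≢a | no t≢b | no t≢c = contradiction (t , t∈p , t≢a , t≢b , t≢c) none

enum : ∀ {n} (p : Subset n) → Fin ∣ p ∣ → Fin n
enum (true ∷ p) zero = zero
enum (true ∷ p) (suc i) = suc (enum p i)
enum (false ∷ p) i = suc (enum p i)

enum-∈ : ∀ {n} (p : Subset n) i → enum p i ∈ p
enum-∈ (true ∷ p) zero = here
enum-∈ (true ∷ p) (suc i) = there (enum-∈ p i)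
enum-∈ (false ∷ p) i = there (enum-∈ p i)

enum-injective : ∀ {n} (p : Subset n) {i j} → enum p i ≡ enum p j → i ≡ j
enum-injective (true ∷ p) {zero} {zero} e = refl
enum-injective (true ∷ p) {suc i} {suc j} e = cong suc (enum-injective p (suc-injective e))
enum-injective (false ∷ p) e = enum-injective p (suc-injective e)

enum-onto : ∀ {n} (p : Subset n) {x} → x ∈ p → ∃ λ i → enum p i ≡ x
enum-onto (true ∷ p) here = zero , refl
enum-onto (true ∷ p) (there x∈p) with enum-onto p x∈p
... | i , e = suc i , cong suc e
enum-onto (false ∷ p) (there x∈p) with enum-onto p x∈p
... | i , e = i , cong suc e

record Enumeration {n} (p : Subset n) (m : ℕ) : Set where
  field
    elem      : Fin m → Fin n
    elem-∈    : ∀ i → elem i ∈ p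
    injective : ∀ {i j} → elem i ≡ elem j → i ≡ j
    onto      : ∀ {x} → x ∈ p → ∃ λ i → elem i ≡ x

enumeration : ∀ {n m} (p : Subset n) → ∣ p ∣ ≡ m → Enumeration p m
enumeration p ∣p∣≡m = record
  { elem      = enum p ∘ cast (sym ∣p∣≡m)
  ; elem-∈    = enum-∈ p ∘ cast (sym ∣p∣≡m)
  ; injective = λ {i} {j} e →
      trans (sym (cast-involutive ∣p∣≡m (sym ∣p∣≡m) i))
        (trans (cong (cast ∣p∣≡m) (enum-injective p e)) (cast-involutive ∣p∣≡m (sym ∣p∣≡m) j))
  ; onto      = λ x∈p → let (i , e) = enum-onto p x∈p in
      cast ∣p∣≡m i , trans (cong (enum p) (cast-involutive (sym ∣p∣≡m) ∣p∣≡m i)) e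
  }

extend : ∀ {n m} {p : Subset n} {x} → x ∉ p → Enumeration p m → Enumeration (⁅ x ⁆ ∪ p) (suc m)
extend {p = p} {x} x∉p E = record
  { elem = elem′ ; elem-∈ = elem′-∈ ; injective = injective′ ; onto = onto′ }
  where
  module E = Enumeration E
  elem′ : Fin (suc _) → Fin _
  elem′ zero = x
  elem′ (suc i) = E.elem i
  elem′-∈ : ∀ i → elem′ i ∈ ⁅ x ⁆ ∪ p
  elem′-∈ zero = x∈p∪q⁺ (inj₁ (x∈⁅x⁆ x))
  elem′-∈ (suc i) = x∈p∪q⁺ (inj₂ (E.elem-∈ i))
  injective′ : ∀ {i j} → elem′ i ≡ elem′ j → i ≡ j
  injective′ {zero} {zero} e = refl
  injective′ {zero} {suc j} e = contradiction (subst (_∈ p) (sym e) (E.elem-∈ j)) x∉p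
  injective′ {suc i} {zero} e = contradiction (subst (_∈ p) e (E.elem-∈ i)) x∉p
  injective′ {suc i} {suc j} e = cong suc (E.injective e)
  onto′ : ∀ {y} → y ∈ ⁅ x ⁆ ∪ p → ∃ λ i → elem′ i ≡ y
  onto′ {y} y∈ with x∈p∪q⁻ ⁅ x ⁆ p y∈
  ... | inj₁ y∈⁅x⁆ = zero , sym (x∈⁅y⁆⇒x≡y x y∈⁅x⁆)
  ... | inj₂ y∈p = let (i , e) = E.onto y∈p in suc i , e

third : Fin 3 → Fin 3 → Fin 3
third zero (suc zero) = suc (suc zero)
third (suc zero) zero = suc (suc zero)
third zero _ = suc zero
third (suc zero) _ = zero
third (suc (suc zero)) zero = suc zero
third (suc (suc zero)) _ = zero

third-unique : ∀ {a b c : Fin 3} → a ≢ b → c ≢ a → c ≢ b → c ≡ third a b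
third-unique {a} {b} {c} = from-yes
  (all? λ a → all? λ b → all? λ c →
    ¬? (a ≟ b) →-dec ¬? (c ≟ a) →-dec ¬? (c ≟ b) →-dec c ≟ third a b) a b c

third-distinct : ∀ {a b : Fin 3} → a ≢ b → third a b ≢ a × third a b ≢ b
third-distinct {a} {b} = from-yes
  (all? λ a → all? λ b → ¬? (a ≟ b) →-dec ¬? (third a b ≟ a) ×-dec ¬? (third a b ≟ b)) a b

outside-pair-equal : ∀ {a b c d : Fin 3} → a ≢ b → c ≢ a → c ≢ b → d ≢ a → d ≢ b → c ≡ d
outside-pair-equal a≢b c≢a c≢b d≢a d≢b = trans (third-unique a≢b c≢a c≢b) (sym (third-unique a≢b d≢a d≢b))

another : Fin 3 → Fin 3
another zero = suc zero
another (suc _) = zero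

another≢ : ∀ j → another j ≢ j
another≢ zero = λ ()
another≢ (suc j) = λ ()

second-associates : ∀ {n} (R : Fin n → Fin n → Bool) {x y} →
  x ≢ y → R x y ≡ false → assoc R c2 x y ≡ true
second-associates R {x} {y} x≢y Rxy≡false rewrite Rxy≡false with x ≟ y
... | yes x≡y = contradiction x≡y x≢y
... | no _ = refl

record LocalCliques {n} (R : Fin n → Fin n → Bool) (m : ℕ) (x : Fin n) : Set where
  field
    part          : Fin 3 → Subset n
    part-complete : ∀ {t} → R x t ≡ true → ∃ λ k → t ∈ part k
    part-adjacent : ∀ k {t} → t ∈ part k → R x t ≡ true
    part-size     : ∀ k → ∣ part k ∣ ≡ m
    part-disjoint : ∀ {k k'} → k ≢ k' → Disjoint (part k) (part k')
    part-clique   : ∀ k → Clique R (part k)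
    part-matching : ∀ {k k'} → k ≢ k' → ExactlyOneNbr R (part k) (part k')

localCliques : ∀ {n m} {R : Fin n → Fin n → Bool} {x Y Z W} →
  CondI (suc m) R x Y Z W → CondI' R Y Z W → LocalCliques R m x
localCliques {n} {m} {R} {x} {Y} {Z} {W}
  (assocs , ∣Y∣ , ∣Z∣ , ∣W∣ , Y∩Z , Y∩W , Z∩W , Y-clique , Z-clique , W-clique)
  (Y→Z , Y→W , Z→Y , Z→W , W→Y , W→Z) = record
  { part = part ; part-complete = complete ; part-adjacent = adjacent ; part-size = size
  ; part-disjoint = disjoint ; part-clique = clique ; part-matching = matching }
  where
  part : Fin 3 → Subset n
  part zero = Y
  part (suc zero) = Z
  part (suc (suc zero)) = W

  complete : ∀ {t} → R x t ≡ true → ∃ λ k → t ∈ part k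
  complete {t} Rxt with proj₂ (assocs t) Rxt
  ... | inj₁ t∈Y = zero , t∈Y
  ... | inj₂ (inj₁ t∈Z) = suc zero , t∈Z
  ... | inj₂ (inj₂ t∈W) = suc (suc zero) , t∈W

  adjacent : ∀ k {t} → t ∈ part k → R x t ≡ true
  adjacent zero {t} t∈ = proj₁ (assocs t) (inj₁ t∈)
  adjacent (suc zero) {t} t∈ = proj₁ (assocs t) (inj₂ (inj₁ t∈))
  adjacent (suc (suc zero)) {t} t∈ = proj₁ (assocs t) (inj₂ (inj₂ t∈))

  size : ∀ k → ∣ part k ∣ ≡ m
  size zero = ∣Y∣
  size (suc zero) = ∣Z∣
  size (suc (suc zero)) = ∣W∣

  disjoint : ∀ {k k'} → k ≢ k' → Disjoint (part k) (part k')
  disjoint {zero} {suc zero} _ = Y∩Z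
  disjoint {zero} {suc (suc zero)} _ = Y∩W
  disjoint {suc zero} {zero} _ = disjoint-sym Y∩Z
  disjoint {suc zero} {suc (suc zero)} _ = Z∩W
  disjoint {suc (suc zero)} {zero} _ = disjoint-sym Y∩W
  disjoint {suc (suc zero)} {suc zero} _ = disjoint-sym Z∩W
  disjoint {zero} {zero} k≢k = contradiction refl k≢k
  disjoint {suc zero} {suc zero} k≢k = contradiction refl k≢k
  disjoint {suc (suc zero)} {suc (suc zero)} k≢k = contradiction refl k≢k

  clique : ∀ k → Clique R (part k)
  clique zero = Y-clique
  clique (suc zero) = Z-clique
  clique (suc (suc zero)) = W-clique

  matching : ∀ {k k'} → k ≢ k' → ExactlyOneNbr R (part k) (part k')
  matching {zero} {suc zero} _ = Y→Z
  matching {zero} {suc (suc zero)} _ = Y→W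
  matching {suc zero} {zero} _ = Z→Y
  matching {suc zero} {suc (suc zero)} _ = Z→W
  matching {suc (suc zero)} {zero} _ = W→Y
  matching {suc (suc zero)} {suc zero} _ = W→Z
  matching {zero} {zero} k≢k = contradiction refl k≢k
  matching {suc zero} {suc zero} k≢k = contradiction refl k≢k
  matching {suc (suc zero)} {suc (suc zero)} k≢k = contradiction refl k≢k

module Geometry {n m : ℕ} (R : Fin n → Fin n → Bool)
  (irreflexive : ∀ x → R x x ≡ false) (symmetric : ∀ x y → R x y ≡ R y x)
  (local : ∀ x → LocalCliques R m x) (4≤m : 4 ≤ m) where

  Pt : Set
  Pt = Fin n

  module At (x : Pt) = LocalCliques (local x)
  open At

  _~_ : Pt → Pt → Set
  a ~ b = R a b ≡ true

  ~-sym : ∀ {a b} → a ~ b → b ~ a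
  ~-sym {a} {b} a~b = trans (symmetric b a) a~b

  Nb : Pt → Subset n
  Nb a = assocSet R c1 a

  ~⇒∈Nb : ∀ {a b} → a ~ b → b ∈ Nb a
  ~⇒∈Nb {a} = ∈-tabulate⁺ (R a)

  ∈Nb⇒~ : ∀ {a b} → b ∈ Nb a → a ~ b
  ∈Nb⇒~ {a} = ∈-tabulate⁻ (R a)

  part-irrefl : ∀ x k {t} → t ∈ part x k → t ≢ x
  part-irrefl x k t∈ refl with trans (sym (part-adjacent x k t∈)) (irreflexive x)
  ... | ()

  part-unique : ∀ x {k k' t} → t ∈ part x k → t ∈ part x k' → k ≡ k'
  part-unique x {k} {k'} {t} t∈k t∈k' with k ≟ k'
  ... | yes k≡k' = k≡k'
  ... | no k≢k' = contradiction (t∈k , t∈k') (part-disjoint x k≢k' t)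

  matched : ∀ x {k k' a} → k ≢ k' → a ∈ part x k → ∃ λ b → b ∈ part x k' × a ~ b
  matched x {k} {k'} {a} k≢k' a∈ with ∣p∣≡1⇒nonempty (part-matching x k≢k' a a∈)
  ... | b , b∈ = let (b∈k' , b∈Nb) = x∈p∩q⁻ (part x k') (Nb a) b∈ in b , b∈k' , ∈Nb⇒~ b∈Nb

  matched-unique : ∀ x {k k' a b b'} → k ≢ k' → a ∈ part x k →
    b ∈ part x k' → b' ∈ part x k' → a ~ b → a ~ b' → b ≡ b'
  matched-unique x {a = a} k≢k' a∈ b∈ b'∈ a~b a~b' =
    ∣p∣≡1⇒unique (part-matching x k≢k' a a∈) (x∈p∩q⁺ (b∈ , ~⇒∈Nb a~b)) (x∈p∩q⁺ (b'∈ , ~⇒∈Nb a~b'))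

  avoid-in-part : ∀ x k a b c → ∃ λ t → t ∈ part x k × t ≢ a × t ≢ b × t ≢ c
  avoid-in-part x k = avoid (part x k) (subst (4 ≤_) (sym (part-size x k)) 4≤m)

  FurtherCommonNbr : Pt → Pt → Pt → Pt → Set
  FurtherCommonNbr u a b c = u ~ c × a ~ c × b ~ c × c ≢ a × c ≢ b

  -- A further
  -- common neighbour c of u, a, b lies in the third class at u: it cannot lie in the class
  -- of a (resp. b), where b (resp. a) has only one first associate.
  common-nbr-third : ∀ u {ka kb a b c} → ka ≢ kb → a ∈ part u ka → b ∈ part u kb → a ~ b →
    FurtherCommonNbr u a b c → c ∈ part u (third ka kb)
  common-nbr-third u {ka} {kb} {c = c} ka≢kb a∈ b∈ a~b (u~c , a~c , b~c , c≢a , c≢b)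
    with part-complete u u~c
  ... | kc , c∈ with kc ≟ ka | kc ≟ kb
  ... | yes refl | _ =
    contradiction (sym (matched-unique u (ka≢kb ∘ sym) b∈ a∈ c∈ (~-sym a~b) b~c)) c≢a
  ... | _ | yes refl = contradiction (sym (matched-unique u ka≢kb a∈ b∈ c∈ a~b a~c)) c≢b
  ... | no kc≢ka | no kc≢kb = subst (λ k → c ∈ part u k) (third-unique ka≢kb kc≢ka kc≢kb) c∈

  -- Hence such a further common neighbour is unique: it is the match of a in the third class.
  common-nbr-unique : ∀ u {ka kb a b c d} → ka ≢ kb → a ∈ part u ka → b ∈ part u kb → a ~ b →
    FurtherCommonNbr u a b c → FurtherCommonNbr u a b d → c ≡ d
  common-nbr-unique u ka≢kb a∈ b∈ a~b c-nbr d-nbr =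
    matched-unique u (proj₁ (third-distinct ka≢kb) ∘ sym) a∈
      (common-nbr-third u ka≢kb a∈ b∈ a~b c-nbr) (common-nbr-third u ka≢kb a∈ b∈ a~b d-nbr)
      (proj₁ (proj₂ c-nbr)) (proj₁ (proj₂ d-nbr))

  Line : Set
  Line = Pt × Fin 3

  pts : Line → Subset n
  pts (x , k) = ⁅ x ⁆ ∪ part x k

  base∈pts : ∀ x k → x ∈ pts (x , k)
  base∈pts x k = x∈p∪q⁺ (inj₁ (x∈⁅x⁆ x))

  part⊆pts : ∀ x k {t} → t ∈ part x k → t ∈ pts (x , k)
  part⊆pts x k t∈ = x∈p∪q⁺ (inj₂ t∈)

  pts⁻ : ∀ x k {t} → t ∈ pts (x , k) → t ≡ x ⊎ t ∈ part x k
  pts⁻ x k t∈ with x∈p∪q⁻ ⁅ x ⁆ (part x k) t∈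
  ... | inj₁ t∈⁅x⁆ = inj₁ (x∈⁅y⁆⇒x≡y x t∈⁅x⁆)
  ... | inj₂ t∈k = inj₂ t∈k

  pts-off-base : ∀ x k {t} → t ∈ pts (x , k) → t ≢ x → t ∈ part x k
  pts-off-base x k t∈ t≢x with pts⁻ x k t∈
  ... | inj₁ t≡x = contradiction t≡x t≢x
  ... | inj₂ t∈k = t∈k

  pts-clique : ∀ ℓ → Clique R (pts ℓ)
  pts-clique (x , k) a b a∈ b∈ a≢b with pts⁻ x k a∈ | pts⁻ x k b∈
  ... | inj₁ refl | inj₁ refl = contradiction refl a≢b
  ... | inj₁ refl | inj₂ b∈k = part-adjacent x k b∈k
  ... | inj₂ a∈k | inj₁ refl = ~-sym (part-adjacent x k a∈k)
  ... | inj₂ a∈k | inj₂ b∈k = part-clique x k a b a∈k b∈k a≢b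

  -- If u is in the k-th class at x and x in the j-th class at u, then every other member t
  -- of the k-th class at x is in the j-th class at u.  Otherwise x and t are adjacent
  -- members of different classes at u, and any two points of the k-th class at x other
  -- than u and t would be two further common neighbours of u, x, t.
  class⊆line : ∀ x k u j → u ∈ part x k → x ∈ part u j → ∀ {t} → t ∈ part x k → t ∈ pts (u , j)
  class⊆line x k u j u∈ x∈ {t} t∈ with t ≟ u
  ... | yes refl = base∈pts t j
  ... | no t≢u with part-complete u (part-clique x k u t u∈ t∈ (t≢u ∘ sym))
  ... | kt , t∈kt with kt ≟ j
  ... | yes refl = part⊆pts u kt t∈kt
  ... | no kt≢j with avoid-in-part x k u t t
  ... | c , c∈ , c≢u , c≢t , _ with avoid-in-part x k u t c
  ... | d , d∈ , d≢u , d≢t , d≢c =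
    contradiction (common-nbr-unique u (kt≢j ∘ sym) x∈ t∈kt (part-adjacent x k t∈)
                     (further c∈ c≢u c≢t) (further d∈ d≢u d≢t))
                  (d≢c ∘ sym)
    where
    further : ∀ {e} → e ∈ part x k → e ≢ u → e ≢ t → FurtherCommonNbr u x t e
    further {e} e∈ e≢u e≢t =
      part-clique x k u e u∈ e∈ (e≢u ∘ sym) , part-adjacent x k e∈ ,
      part-clique x k t e t∈ e∈ (e≢t ∘ sym) , part-irrefl x k e∈ , e≢t

  same-line : ∀ x k u j → u ∈ part x k → x ∈ part u j → pts (x , k) ≡ pts (u , j)
  same-line x k u j u∈ x∈ = ⊆-antisym (included x k u j u∈ x∈) (included u j x k x∈ u∈)
    where
    included : ∀ x k u j → u ∈ part x k → x ∈ part u j → pts (x , k) ⊆ pts (u , j)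
    included x k u j u∈ x∈ t∈ with pts⁻ x k t∈
    ... | inj₁ refl = part⊆pts u j x∈
    ... | inj₂ t∈k = class⊆line x k u j u∈ x∈ t∈k

  line-through : ∀ ℓ {t} → t ∈ pts ℓ → ∃ λ j → pts ℓ ≡ pts (t , j)
  line-through (x , k) {t} t∈ with pts⁻ x k t∈
  ... | inj₁ refl = k , refl
  ... | inj₂ t∈k = let (j , x∈j) = part-complete t (~-sym (part-adjacent x k t∈k)) in
                   j , same-line x k t j t∈k x∈j

  two-points : ∀ ℓ ℓ' {a b} → a ≢ b →
    a ∈ pts ℓ → b ∈ pts ℓ → a ∈ pts ℓ' → b ∈ pts ℓ' → pts ℓ ≡ pts ℓ'
  two-points ℓ ℓ' {a} {b} a≢b a∈ℓ b∈ℓ a∈ℓ' b∈ℓ'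
    with line-through ℓ a∈ℓ | line-through ℓ' a∈ℓ'
  ... | j , ℓ≡ | j' , ℓ'≡ = trans ℓ≡ (trans (cong (λ k → pts (a , k)) j≡j') (sym ℓ'≡))
    where
    j≡j' : j ≡ j'
    j≡j' = part-unique a (pts-off-base a j (subst (b ∈_) ℓ≡ b∈ℓ) (a≢b ∘ sym))
                         (pts-off-base a j' (subst (b ∈_) ℓ'≡ b∈ℓ') (a≢b ∘ sym))

  data _∥_ (ℓ ℓ' : Line) : Set where
    same  : pts ℓ ≡ pts ℓ' → ℓ ∥ ℓ'
    apart : Disjoint (pts ℓ) (pts ℓ') → ℓ ∥ ℓ'

  ∥-sym : ∀ {ℓ ℓ'} → ℓ ∥ ℓ' → ℓ' ∥ ℓ
  ∥-sym (same e) = same (sym e)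
  ∥-sym (apart d) = apart (disjoint-sym d)

  ∥-common-point : ∀ {ℓ ℓ' t} → ℓ ∥ ℓ' → t ∈ pts ℓ → t ∈ pts ℓ' → pts ℓ ≡ pts ℓ'
  ∥-common-point (same e) _ _ = e
  ∥-common-point {t = t} (apart d) t∈ t∈' = contradiction (t∈ , t∈') (d t)

  crossing : ∀ x {k k'} → k ≢ k' → ¬ (x , k) ∥ (x , k')
  crossing x {k} {k'} k≢k' (apart d) = d x (base∈pts x k , base∈pts x k')
  crossing x {k} {k'} k≢k' (same e) with avoid-in-part x k x x x
  ... | c , c∈ , c≢x , _ with pts⁻ x k' (subst (c ∈_) e (part⊆pts x k c∈))
  ... | inj₁ c≡x = c≢x c≡x
  ... | inj₂ c∈k' = part-disjoint x k≢k' c (c∈ , c∈k')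

  meet : ∀ {ℓ ℓ'} → ¬ ℓ ∥ ℓ' → Nonempty (pts ℓ ∩ pts ℓ')
  meet {ℓ} {ℓ'} ℓ∦ℓ' with nonempty? (pts ℓ ∩ pts ℓ')
  ... | yes ne = ne
  ... | no none = contradiction (apart (λ t t∈ → none (t , x∈p∩q⁺ t∈))) ℓ∦ℓ'

  meet-once : ∀ {ℓ ℓ'} → ¬ ℓ ∥ ℓ' → ∣ pts ℓ ∩ pts ℓ' ∣ ≡ 1
  meet-once {ℓ} {ℓ'} ℓ∦ℓ' with meet ℓ∦ℓ'
  ... | t , t∈ = singleton⇒∣p∣≡1 t∈ only-t
    where
    only-t : ∀ {y} → y ∈ pts ℓ ∩ pts ℓ' → y ≡ t
    only-t {y} y∈ with y ≟ t
    ... | yes y≡t = y≡t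
    ... | no y≢t =
      let (y∈ℓ , y∈ℓ') = x∈p∩q⁻ (pts ℓ) (pts ℓ') y∈
          (t∈ℓ , t∈ℓ') = x∈p∩q⁻ (pts ℓ) (pts ℓ') t∈
      in contradiction (same (two-points ℓ ℓ' y≢t y∈ℓ t∈ℓ y∈ℓ' t∈ℓ')) ℓ∦ℓ'

  -- A point t off a line ℓ that is adjacent to a ∈ ℓ is adjacent to exactly one other point
  -- b of ℓ: seen from a, ℓ is a class at a not containing t, and b is the match of t in it.
  second-nbr : ∀ ℓ {t a} → t ∉ pts ℓ → a ∈ pts ℓ → t ~ a →
    ∃ λ b → b ∈ pts ℓ × t ~ b × b ≢ a × (∀ {y} → y ∈ pts ℓ → t ~ y → y ≡ a ⊎ y ≡ b)
  second-nbr ℓ {t} {a} t∉ℓ a∈ℓ t~a with line-through ℓ a∈ℓ | part-complete a (~-sym t~a)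
  ... | j , ℓ≡ | kt , t∈kt with kt ≟ j
  ... | yes refl = contradiction (subst (t ∈_) (sym ℓ≡) (part⊆pts a kt t∈kt)) t∉ℓ
  ... | no kt≢j with matched a kt≢j t∈kt
  ... | b , b∈j , t~b = b , on-ℓ (part⊆pts a j b∈j) , t~b , part-irrefl a j b∈j , others
    where
    on-ℓ : ∀ {y} → y ∈ pts (a , j) → y ∈ pts ℓ
    on-ℓ {y} = subst (y ∈_) (sym ℓ≡)
    others : ∀ {y} → y ∈ pts ℓ → t ~ y → y ≡ a ⊎ y ≡ b
    others {y} y∈ℓ t~y with pts⁻ a j (subst (y ∈_) ℓ≡ y∈ℓ)
    ... | inj₁ y≡a = inj₁ y≡a
    ... | inj₂ y∈j = inj₂ (matched-unique a kt≢j t∈kt y∈j b∈j t~y t~b)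

  off-line-nbrs≤2 : ∀ ℓ {t} → t ∉ pts ℓ → ∣ pts ℓ ∩ Nb t ∣ ≤ 2
  off-line-nbrs≤2 ℓ {t} t∉ℓ with nonempty? (pts ℓ ∩ Nb t)
  ... | no none = ⊆pair⇒∣p∣≤2 t t (λ {y} y∈ → contradiction (y , y∈) none)
  ... | yes (a , a∈) with x∈p∩q⁻ (pts ℓ) (Nb t) a∈
  ... | a∈ℓ , a∈Nb with second-nbr ℓ t∉ℓ a∈ℓ (∈Nb⇒~ a∈Nb)
  ... | b , _ , _ , _ , others = ⊆pair⇒∣p∣≤2 a b covered
    where
    covered : pts ℓ ∩ Nb t ⊆ ⁅ a ⁆ ∪ ⁅ b ⁆
    covered {y} y∈ with x∈p∩q⁻ (pts ℓ) (Nb t) y∈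
    ... | y∈ℓ , y∈Nb with others y∈ℓ (∈Nb⇒~ y∈Nb)
    ... | inj₁ refl = x∈p∪q⁺ (inj₁ (x∈⁅x⁆ y))
    ... | inj₂ refl = x∈p∪q⁺ (inj₂ (x∈⁅x⁆ y))

  module Parallelism (common-nbrs : ∀ x y → assoc R c2 x y ≡ true → ∣ Nb x ∩ Nb y ∣ ≡ 6) where

    -- A point t off a line (x , k) is adjacent to some point of it.  Otherwise t and x are
    -- second associates, and their 6 common first associates lie on the two other lines
    -- through x, each containing at most two first associates of t.
    off-line-nbr : ∀ ℓ {t} → t ∉ pts ℓ → ∃ λ a → a ∈ pts ℓ × t ~ a
    off-line-nbr (x , k) {t} t∉ℓ with nonempty? (pts (x , k) ∩ Nb t)
    ... | yes (a , a∈) =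
      let (a∈ℓ , a∈Nb) = x∈p∩q⁻ (pts (x , k)) (Nb t) a∈ in a , a∈ℓ , ∈Nb⇒~ a∈Nb
    ... | no none = contradiction (subst (_≤ 4) (common-nbrs x t x-t-second) bound)
                                  (λ { (s≤s (s≤s (s≤s (s≤s ())))) })
      where
      k₁ k₂ : Fin 3
      k₁ = another k
      k₂ = third k k₁

      x≢t : x ≢ t
      x≢t x≡t = t∉ℓ (subst (_∈ pts (x , k)) x≡t (base∈pts x k))

      x≁t : R x t ≡ false
      x≁t = ¬-not {y = true} λ x~t → none (x , x∈p∩q⁺ (base∈pts x k , ~⇒∈Nb (~-sym x~t)))

      x-t-second : assoc R c2 x t ≡ true
      x-t-second = second-associates R x≢t x≁t

      t∉lines : ∀ k' → t ∉ pts (x , k')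
      t∉lines k' t∈ with pts⁻ x k' t∈
      ... | inj₁ t≡x = x≢t (sym t≡x)
      ... | inj₂ t∈k' = contradiction (trans (sym (part-adjacent x k' t∈k')) x≁t) λ ()

      covered : Nb x ∩ Nb t ⊆ (pts (x , k₁) ∩ Nb t) ∪ (pts (x , k₂) ∩ Nb t)
      covered {y} y∈ with x∈p∩q⁻ (Nb x) (Nb t) y∈
      ... | y∈Nbx , y∈Nbt with part-complete x (∈Nb⇒~ y∈Nbx)
      ... | ky , y∈ky with ky ≟ k | ky ≟ k₁
      ... | yes refl | _ = contradiction (y , x∈p∩q⁺ (part⊆pts x ky y∈ky , y∈Nbt)) none
      ... | no _ | yes refl = x∈p∪q⁺ (inj₁ (x∈p∩q⁺ (part⊆pts x ky y∈ky , y∈Nbt)))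
      ... | no ky≢k | no ky≢k₁ = x∈p∪q⁺ (inj₂ (x∈p∩q⁺ (part⊆pts x k₂ y∈k₂ , y∈Nbt)))
        where
        y∈k₂ : y ∈ part x k₂
        y∈k₂ = subst (λ k' → y ∈ part x k')
                     (third-unique (another≢ k ∘ sym) ky≢k ky≢k₁) y∈ky

      bound : ∣ Nb x ∩ Nb t ∣ ≤ 4
      bound = ≤-trans (p⊆q⇒∣p∣≤∣q∣ covered)
                (≤-trans (∣p∪q∣≤∣p∣+∣q∣ (pts (x , k₁) ∩ Nb t) (pts (x , k₂) ∩ Nb t))
                  (+-mono-≤ (off-line-nbrs≤2 (x , k₁) (t∉lines k₁))
                            (off-line-nbrs≤2 (x , k₂) (t∉lines k₂))))

    record OffLine (ℓ : Line) (t : Pt) : Set where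
      field
        k₁ k₂   : Fin 3
        k₁≢k₂   : k₁ ≢ k₂
        meets₁  : Nonempty (pts (t , k₁) ∩ pts ℓ)
        meets₂  : Nonempty (pts (t , k₂) ∩ pts ℓ)
        missing : Disjoint (pts (t , third k₁ k₂)) (pts ℓ)

    off-line : ∀ ℓ {t} → t ∉ pts ℓ → OffLine ℓ t
    off-line ℓ {t} t∉ℓ with off-line-nbr ℓ t∉ℓ
    ... | a , a∈ℓ , t~a with second-nbr ℓ t∉ℓ a∈ℓ t~a
    ... | b , b∈ℓ , t~b , b≢a , others with part-complete t t~a | part-complete t t~b
    ... | ka , a∈ka | kb , b∈kb = record
      { k₁ = ka ; k₂ = kb ; k₁≢k₂ = ka≢kb
      ; meets₁ = a , x∈p∩q⁺ (part⊆pts t ka a∈ka , a∈ℓ)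
      ; meets₂ = b , x∈p∩q⁺ (part⊆pts t kb b∈kb , b∈ℓ)
      ; missing = missing }
      where
      -- a line through t containing both a and b would be ℓ itself
      ka≢kb : ka ≢ kb
      ka≢kb ka≡kb =
        t∉ℓ (subst (t ∈_)
                   (two-points (t , ka) ℓ (b≢a ∘ sym) (part⊆pts t ka a∈ka)
                      (part⊆pts t ka (subst (λ k → b ∈ part t k) (sym ka≡kb) b∈kb)) a∈ℓ b∈ℓ)
                   (base∈pts t ka))
      -- a common point y would be a first associate of t on ℓ, i.e. a or b, which lie
      -- in the other two classes at t
      missing : Disjoint (pts (t , third ka kb)) (pts ℓ)
      missing y (y∈t , y∈ℓ) with pts⁻ t (third ka kb) y∈t
      ... | inj₁ refl = t∉ℓ y∈ℓ
      ... | inj₂ y∈third with others y∈ℓ (part-adjacent t (third ka kb) y∈third)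
      ... | inj₁ refl = proj₁ (third-distinct ka≢kb) (part-unique t y∈third a∈ka)
      ... | inj₂ refl = proj₂ (third-distinct ka≢kb) (part-unique t y∈third b∈kb)

    unique-parallel : ∀ ℓ {t j j'} → t ∉ pts ℓ →
      Disjoint (pts (t , j)) (pts ℓ) → Disjoint (pts (t , j')) (pts ℓ) → j ≡ j'
    unique-parallel ℓ {t} t∉ℓ d d' =
      outside-pair-equal k₁≢k₂ (misses d meets₁) (misses d meets₂)
                               (misses d' meets₁) (misses d' meets₂)
      where
      open OffLine (off-line ℓ t∉ℓ)
      misses : ∀ {j k} → Disjoint (pts (t , j)) (pts ℓ) → Nonempty (pts (t , k) ∩ pts ℓ) → j ≢ k
      misses d (y , y∈) refl = d y (x∈p∩q⁻ _ _ y∈)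

    parallel-through : ∀ ℓ t → ∃ λ j → (t , j) ∥ ℓ
    parallel-through ℓ t with t ∈? pts ℓ
    ... | yes t∈ℓ = let (j , ℓ≡) = line-through ℓ t∈ℓ in j , same (sym ℓ≡)
    ... | no t∉ℓ = let open OffLine (off-line ℓ t∉ℓ) in third k₁ k₂ , apart missing

    -- Parallelism is transitive: two lines parallel to ℓ₂ through a common point t ∉ ℓ₂
    -- are both the unique line through t missing ℓ₂.
    ∥-trans : ∀ {ℓ₁ ℓ₂ ℓ₃} → ℓ₁ ∥ ℓ₂ → ℓ₂ ∥ ℓ₃ → ℓ₁ ∥ ℓ₃
    ∥-trans (same e) (same e') = same (trans e e')
    ∥-trans (same e) (apart d) = apart (subst (λ A → Disjoint A _) (sym e) d)
    ∥-trans (apart d) (same e) = apart (subst (Disjoint _) e d)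
    ∥-trans {ℓ₁} {ℓ₂} {ℓ₃} (apart d₁₂) (apart d₂₃) with nonempty? (pts ℓ₁ ∩ pts ℓ₃)
    ... | no none = apart (λ t t∈ → none (t , x∈p∩q⁺ t∈))
    ... | yes (t , t∈) with x∈p∩q⁻ (pts ℓ₁) (pts ℓ₃) t∈
    ... | t∈ℓ₁ , t∈ℓ₃ with line-through ℓ₁ t∈ℓ₁ | line-through ℓ₃ t∈ℓ₃
    ... | j₁ , ℓ₁≡ | j₃ , ℓ₃≡ = same (trans ℓ₁≡ (trans (cong (λ j → pts (t , j)) j₁≡j₃) (sym ℓ₃≡)))
      where
      t∉ℓ₂ : t ∉ pts ℓ₂
      t∉ℓ₂ t∈ℓ₂ = d₁₂ t (t∈ℓ₁ , t∈ℓ₂)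
      j₁≡j₃ : j₁ ≡ j₃
      j₁≡j₃ = unique-parallel ℓ₂ t∉ℓ₂ (subst (λ A → Disjoint A (pts ℓ₂)) ℓ₁≡ d₁₂)
                                      (subst (λ A → Disjoint A (pts ℓ₂)) ℓ₃≡ (disjoint-sym d₂₃))

    ∦-transfer : ∀ {ℓ₁ ℓ₂ ℓ₁' ℓ₂'} → ℓ₁ ∥ ℓ₁' → ℓ₂ ∥ ℓ₂' → ¬ ℓ₁' ∥ ℓ₂' → ¬ ℓ₁ ∥ ℓ₂
    ∦-transfer p₁ p₂ ∦ p = ∦ (∥-trans (∥-sym p₁) (∥-trans p p₂))

    module ParallelClasses (x₀ : Pt) where

      transversal : Fin 3 → Line
      transversal v = x₀ , another v

      transversal-points : ∀ v → Enumeration (pts (transversal v)) (suc m)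
      transversal-points v =
        extend (λ x₀∈ → part-irrefl x₀ (another v) x₀∈ refl)
               (enumeration (part x₀ (another v)) (part-size x₀ (another v)))

      module T (v : Fin 3) = Enumeration (transversal-points v)

      parallel-line : Fin 3 → Pt → Line
      parallel-line v p = p , proj₁ (parallel-through (x₀ , v) p)

      parallel-line-∥ : ∀ v p → parallel-line v p ∥ (x₀ , v)
      parallel-line-∥ v p = proj₂ (parallel-through (x₀ , v) p)

      parallel∦transversal : ∀ v p → ¬ parallel-line v p ∥ transversal v
      parallel∦transversal v p =
        ∦-transfer (parallel-line-∥ v p) (same refl) (crossing x₀ (another≢ v ∘ sym))

      class : Fin 3 → Fin (suc m) → Subset n
      class v i = pts (parallel-line v (T.elem v i))

      class-clique : ∀ v i → Clique R (class v i)
      class-clique v i = pts-clique (parallel-line v (T.elem v i))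

      -- two equal classes would contain two points of the transversal, hence be it
      class-disjoint : ∀ v i j → i ≢ j → Disjoint (class v i) (class v j)
      class-disjoint v i j i≢j
        with ∥-trans (parallel-line-∥ v (T.elem v i)) (∥-sym (parallel-line-∥ v (T.elem v j)))
      ... | apart d = d
      ... | same e = contradiction (same (two-points (parallel-line v pᵢ) (transversal v)
                                            (i≢j ∘ T.injective v) pᵢ∈ pⱼ∈ (T.elem-∈ v i) (T.elem-∈ v j)))
                                   (parallel∦transversal v pᵢ)
        where
        pᵢ pⱼ : Pt
        pᵢ = T.elem v i
        pⱼ = T.elem v j
        pᵢ∈ : pᵢ ∈ class v i
        pᵢ∈ = base∈pts pᵢ _
        pⱼ∈ : pⱼ ∈ class v i
        pⱼ∈ = subst (pⱼ ∈_) (sym e) (base∈pts pⱼ _)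

      -- the parallel through t meets the transversal in some point, whose class contains t
      class-cover : ∀ v t → ∃ λ i → t ∈ class v i
      class-cover v t with meet (parallel∦transversal v t)
      ... | q , q∈ with x∈p∩q⁻ (pts (parallel-line v t)) (pts (transversal v)) q∈
      ... | q∈∥ , q∈T with T.onto v q∈T
      ... | i , pᵢ≡q = i , subst (t ∈_) same-class (base∈pts t _)
        where
        q∈class : q ∈ class v i
        q∈class = subst (λ p → q ∈ pts (parallel-line v p)) (sym pᵢ≡q) (base∈pts q _)
        same-class : pts (parallel-line v t) ≡ class v i
        same-class = ∥-common-point (∥-trans (parallel-line-∥ v t)
                                             (∥-sym (parallel-line-∥ v (T.elem v i))))
                                    q∈∥ q∈class

      -- classes of different partitions are parallel to crossing lines
      class-meet : ∀ v u → v ≢ u → ∀ i j → ∣ class v i ∩ class u j ∣ ≡ 1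
      class-meet v u v≢u i j =
        meet-once (∦-transfer (parallel-line-∥ v (T.elem v i)) (parallel-line-∥ u (T.elem u j))
                              (crossing x₀ v≢u))

theorem3p8 : (s : ℕ) → 4 < s → (R : Fin (s * s) → Fin (s * s) → Bool) →
    IsPseudoL3 s R →
    (∀ x → Σ (Subset (s * s)) λ Y → Σ (Subset (s * s)) λ Z → Σ (Subset (s * s)) λ W →
      CondI s R x Y Z W × CondI' R Y Z W) →
    Σ (Fin 3 → Fin s → Subset (s * s)) λ P →
      (∀ v → IsCliquePartition R s (P v)) ×
      (∀ v u → v ≢ u → ∀ i j → ∣ P v i ∩ P u j ∣ ≡ 1)
theorem3p8 zero () R isL H
theorem3p8 (suc m) (s≤s 4≤m) R (_ , _ , scheme , _ , _ , p²₁₁≡6) H =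
  class , (λ v → class-disjoint v , class-cover v , class-clique v) , class-meet
  where
  open IsAssocScheme scheme using (irrefl; intersection) renaming (sym to R-sym)

  local : ∀ x → LocalCliques R m x
  local x with H x
  ... | _ , _ , _ , condI , condI' = localCliques condI condI'

  open Geometry R irrefl R-sym local 4≤m
  open Parallelism (λ x y second → trans (intersection c2 c1 c1 x y second) p²₁₁≡6)
  open ParallelClasses zero
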